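{- For all integers $n, k \geq 1$ with $n \geq k$, $$\sum_{k \le i \le n} \frac{S(n,i)\, s(i,k)}{i} = \frac{1}{n}\binom{n}{k} B_{n-k} + \delta_{n-1,k},$$ where $\delta$ denotes the Kronecker delta.
   Context: $X^{\underline{n}} := X(X-1)\cdots(X-n+1)$. The (signed) Stirling numbers of the first kind $s(n,k)$ are defined by $X^{\underline{n}} = \sum_{k=0}^{n} s(n,k) X^k$, and the Stirling numbers of the second kind $S(n,k)$ by $X^n = \sum_{k=0}^{n} S(n,k) X^{\underline{k}}$ ($n\ge0$), with $s(n,k)=S(n,k)=0$ for $n<k$. The Bernoulli numbers $B_n$ are defined by $\frac{t}{e^t-1} = \sum_{n\ge 0} B_n \frac{t^n}{n!}$. -}

module Defs where

open import Data.Nat as ℕ using (ℕ; zero; suc)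
open import Data.Nat.Combinatorics using (_C_)
open import Data.Integer as ℤ using (ℤ; +_)
open import Data.Rational as ℚ using (ℚ; _/_; 0ℚ; 1ℚ)
open import Relation.Nullary using (yes; no)
open import Data.List using (List; []; _∷_; _++_; [_]; length)

-- Signed Stirling numbers of the first kind s(n,k): the coefficient of X^k in
-- X(X-1)...(X-n+1).  Since X^{(n+1) falling} = (X - n) * X^{n falling}:
--   s(0,0)=1, s(0,k+1)=0, s(n+1,0)=0, s(n+1,k+1) = s(n,k) - n*s(n,k+1).
s : ℕ → ℕ → ℤ
s zero    zero    = + 1
s zero    (suc k) = + 0
s (suc n) zero    = + 0
s (suc n) (suc k) = s n k ℤ.- (+ n) ℤ.* s n (suc k)

-- Stirling numbers of the second kind S(n,k) (X^n = Σ_k S(n,k) X^{k falling}).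
-- From X * X^{k falling} = X^{(k+1) falling} + k X^{k falling}:
--   S(0,0)=1, S(0,k+1)=0, S(n+1,0)=0, S(n+1,k+1) = S(n,k) + (k+1)*S(n,k+1).
S : ℕ → ℕ → ℕ
S zero    zero    = 1
S zero    (suc k) = 0
S (suc n) zero    = 0
S (suc n) (suc k) = S n k ℕ.+ suc k ℕ.* S n (suc k)

-- Bernoulli numbers with t/(e^t-1) = Σ B_n t^n/n!  (so B_1 = -1/2).
-- Comparing coefficients of t^{m+1}/(m+1)! in  t = (e^t - 1) * Σ_n B_n t^n/n!
-- gives B_0 = 1 and, for m ≥ 1,  Σ_{j=0}^{m} C(m+1,j) B_j = 0, i.e.
--   B_m = -(1/(m+1)) * Σ_{j<m} C(m+1,j) B_j .

binomSum : ℕ → ℕ → List ℚ → ℚ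
binomSum N j []       = 0ℚ
binomSum N j (b ∷ bs) = ((+ (N C j)) / 1) ℚ.* b ℚ.+ binomSum N (suc j) bs

nextB : List ℚ → ℚ
nextB bs with length bs
... | zero  = 1ℚ
... | suc m = ℚ.- ((+ 1 / suc (suc m)) ℚ.* binomSum (suc (suc m)) 0 bs)

bernoulliList : ℕ → List ℚ
bernoulliList zero    = []
bernoulliList (suc n) = let bs = bernoulliList n in bs ++ [ nextB bs ]

B : ℕ → ℚ
B n = nextB (bernoulliList n)

Σ[_to_] : ℕ → ℕ → (ℕ → ℚ) → ℚ
Σ[ a to b ] f = go (suc b ℕ.∸ a) a
  where
  go : ℕ → ℕ → ℚ
  go zero    i = 0ℚ
  go (suc c) i = f i ℚ.+ go c (suc i)

δ : ℕ → ℕ → ℚ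
δ a b with a ℕ.≟ b
... | yes _ = 1ℚ
... | no  _ = 0ℚ

module Submission where

-- Put k = K + 1 and n = m + 1, and let x m and r m be the two sides of the identity.  Both
-- sequences solve the triangular system  Σ_{m<N} C(N,m) y_m = C(N,k)  (N ≥ 0), whose solution
-- is unique since the last coefficient C(N+1,N) = N+1 is invertible.  For x this follows by
-- exchanging sums, using S(N+1,j+1) = Σ_m C(N,m) S(m,j) and the orthogonality
-- Σ_i S(n,i) s(i,k) = δ_{n,k}; for r it follows from C(m+1,k)/(m+1) = C(m,K)/k, the trinomial
-- revision C(N,m) C(m,K) = C(N,K) C(N-K,m-K) and the Bernoulli recurrence
-- Σ_{j<L} C(L,j) B_j = δ_{L,1}.

open import Level using (0ℓ)
open import Function using (_∘_)
open import Algebra.Bundles using (Ring)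
open import Data.Empty using (⊥-elim)
open import Data.Sum using ([_,_]′)
open import Data.Fin using (toℕ)
open import Data.Fin.Properties using (toℕ<n; toℕ-inject₁; toℕ-fromℕ)
open import Data.List using ([]; _∷_; _++_; [_]; length)
open import Data.List.Properties using (length-++)
open import Data.Nat as ℕ using (ℕ; zero; suc; _≤_; _<_; _∸_; z≤n; s≤s)
import Data.Nat.Properties as ℕ
open import Data.Nat.Induction using (<-rec)
open import Data.Nat.Combinatorics using (_C_; k>n⇒nCk≡0; nCk+nC[k+1]≡[n+1]C[k+1]; nCn≡1; nC1≡n; nCk≡nC[n∸k])
open import Data.Nat.Tactic.RingSolver using () renaming (ring to ℕ-ring)
open import Data.Integer as ℤ using (ℤ; 1ℤ)
import Data.Integer.Properties as ℤ
open import Data.Integer.Tactic.RingSolver using () renaming (ring to ℤ-ring)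
open import Data.Rational using (ℚ; _/_; _+_; _*_; -_; _-_; 0ℚ; 1ℚ; toℚᵘ)
open import Data.Rational.Properties as ℚ using (toℚᵘ-injective; toℚᵘ-fromℚᵘ)
open import Data.Rational.Unnormalised as ℚᵘ using (mkℚᵘ; *≡*)
import Data.Rational.Unnormalised.Properties as ℚᵘ
open import Algebra.Properties.Group ℚ.+-0-group using (∙-cancelˡ; ∙-cancelʳ)
open import Algebra.Properties.Semiring.Sum (Ring.semiring ℚ.+-*-ring)
  using (sum; sum-cong-≗; sum-replicate-zero; sum-init-last; ∑-distrib-+; ∑-comm; *-distribˡ-sum; *-distribʳ-sum)
open import Relation.Nullary using (yes; no)
open import Relation.Nullary.Decidable using (dec⇒maybe)
open import Relation.Binary.PropositionalEquality hiding ([_])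
open import Tactic.RingSolver using (solve-∀)
open import Tactic.RingSolver.Core.AlmostCommutativeRing using (AlmostCommutativeRing; fromCommutativeRing)
open import Defs

ℚ-ring : AlmostCommutativeRing 0ℓ 0ℓ
ℚ-ring = fromCommutativeRing ℚ.+-*-commutativeRing (λ p → dec⇒maybe (0ℚ ℚ.≟ p))

ι : ℤ → ℚ
ι z = z / 1

ιₙ : ℕ → ℚ
ιₙ n = ι (ℤ.+ n)

-- The weight 1/n of the statement, written as in its denominators suc (n ∸ 1); so 1/ℕ 0 = 1.
1/ℕ : ℕ → ℚ
1/ℕ n = 1ℤ / suc (n ∸ 1)

private
  toℚᵘ-/ : ∀ z d → toℚᵘ (z / suc d) ℚᵘ.≃ mkℚᵘ z d
  toℚᵘ-/ z d = toℚᵘ-fromℚᵘ (mkℚᵘ z d)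

ι-+ : ∀ a b → ι (a ℤ.+ b) ≡ ι a + ι b
ι-+ a b = toℚᵘ-injective (begin
  toℚᵘ (ι (a ℤ.+ b))              ≈⟨ toℚᵘ-/ (a ℤ.+ b) 0 ⟩
  mkℚᵘ (a ℤ.+ b) 0                ≈⟨ *≡* (integral a b) ⟩
  mkℚᵘ a 0 ℚᵘ.+ mkℚᵘ b 0          ≈⟨ ℚᵘ.+-cong (toℚᵘ-/ a 0) (toℚᵘ-/ b 0) ⟨
  toℚᵘ (ι a) ℚᵘ.+ toℚᵘ (ι b)      ≈⟨ ℚ.toℚᵘ-homo-+ (ι a) (ι b) ⟨
  toℚᵘ (ι a + ι b)                ∎)
  where
  open ℚᵘ.≃-Reasoning
  integral : ∀ a b → (a ℤ.+ b) ℤ.* (1ℤ ℤ.* 1ℤ) ≡ (a ℤ.* 1ℤ ℤ.+ b ℤ.* 1ℤ) ℤ.* 1ℤ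
  integral = solve-∀ ℤ-ring

ι-* : ∀ a b → ι (a ℤ.* b) ≡ ι a * ι b
ι-* a b = toℚᵘ-injective (begin
  toℚᵘ (ι (a ℤ.* b))              ≈⟨ toℚᵘ-/ (a ℤ.* b) 0 ⟩
  mkℚᵘ (a ℤ.* b) 0                ≈⟨ *≡* (integral a b) ⟩
  mkℚᵘ a 0 ℚᵘ.* mkℚᵘ b 0          ≈⟨ ℚᵘ.*-cong (toℚᵘ-/ a 0) (toℚᵘ-/ b 0) ⟨
  toℚᵘ (ι a) ℚᵘ.* toℚᵘ (ι b)      ≈⟨ ℚ.toℚᵘ-homo-* (ι a) (ι b) ⟨
  toℚᵘ (ι a * ι b)                ∎)
  where
  open ℚᵘ.≃-Reasoning
  integral : ∀ a b → (a ℤ.* b) ℤ.* (1ℤ ℤ.* 1ℤ) ≡ (a ℤ.* b) ℤ.* 1ℤ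
  integral = solve-∀ ℤ-ring

ι-neg : ∀ a → ι (ℤ.- a) ≡ - ι a
ι-neg a = toℚᵘ-injective (begin
  toℚᵘ (ι (ℤ.- a))                ≈⟨ toℚᵘ-/ (ℤ.- a) 0 ⟩
  mkℚᵘ (ℤ.- a) 0                  ≈⟨ ℚᵘ.-‿cong (toℚᵘ-/ a 0) ⟨
  ℚᵘ.- toℚᵘ (ι a)                 ≈⟨ ℚ.toℚᵘ-homo‿- (ι a) ⟨
  toℚᵘ (- ι a)                    ∎)
  where open ℚᵘ.≃-Reasoning

/-≡-*-1/ℕ : ∀ a d → a / suc d ≡ ι a * 1/ℕ (suc d)
/-≡-*-1/ℕ a d = toℚᵘ-injective (begin
  toℚᵘ (a / suc d)                       ≈⟨ toℚᵘ-/ a d ⟩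
  mkℚᵘ a d                               ≈⟨ *≡* (integral a (ℤ.+ suc d)) ⟩
  mkℚᵘ a 0 ℚᵘ.* mkℚᵘ 1ℤ d                ≈⟨ ℚᵘ.*-cong (toℚᵘ-/ a 0) (toℚᵘ-/ 1ℤ d) ⟨
  toℚᵘ (ι a) ℚᵘ.* toℚᵘ (1/ℕ (suc d))     ≈⟨ ℚ.toℚᵘ-homo-* (ι a) (1/ℕ (suc d)) ⟨
  toℚᵘ (ι a * 1/ℕ (suc d))               ∎)
  where
  open ℚᵘ.≃-Reasoning
  integral : ∀ a d → a ℤ.* (1ℤ ℤ.* d) ≡ (a ℤ.* 1ℤ) ℤ.* d
  integral = solve-∀ ℤ-ring

ιₙ-*-1/ℕ : ∀ n → ιₙ (suc n) * 1/ℕ (suc n) ≡ 1ℚ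
ιₙ-*-1/ℕ n = trans (sym (/-≡-*-1/ℕ (ℤ.+ suc n) n)) (toℚᵘ-injective (begin
  toℚᵘ (ℤ.+ suc n / suc n)       ≈⟨ toℚᵘ-/ (ℤ.+ suc n) n ⟩
  mkℚᵘ (ℤ.+ suc n) n             ≈⟨ *≡* (ℤ.*-comm (ℤ.+ suc n) 1ℤ) ⟩
  ℚᵘ.1ℚᵘ                         ∎))
  where open ℚᵘ.≃-Reasoning

open ≡-Reasoning

ιₙ-+ : ∀ m n → ιₙ (m ℕ.+ n) ≡ ιₙ m + ιₙ n
ιₙ-+ m n = trans (cong ι (ℤ.pos-+ m n)) (ι-+ (ℤ.+ m) (ℤ.+ n))

ιₙ-* : ∀ m n → ιₙ (m ℕ.* n) ≡ ιₙ m * ιₙ n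
ιₙ-* m n = trans (cong ι (ℤ.pos-* m n)) (ι-* (ℤ.+ m) (ℤ.+ n))

1/ℕ-*-ιₙ-* : ∀ n x → 1/ℕ (suc n) * (ιₙ (suc n) * x) ≡ x
1/ℕ-*-ιₙ-* n x = begin
  1/ℕ (suc n) * (ιₙ (suc n) * x)   ≡⟨ ℚ.*-assoc (1/ℕ (suc n)) (ιₙ (suc n)) x ⟨
  1/ℕ (suc n) * ιₙ (suc n) * x     ≡⟨ cong (_* x) (trans (ℚ.*-comm (1/ℕ (suc n)) (ιₙ (suc n))) (ιₙ-*-1/ℕ n)) ⟩
  1ℚ * x                           ≡⟨ ℚ.*-identityˡ x ⟩
  x                                ∎

ιₙ-suc-*-cancelˡ : ∀ n {a b} → ιₙ (suc n) * a ≡ ιₙ (suc n) * b → a ≡ b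
ιₙ-suc-*-cancelˡ n {a} {b} eq =
  trans (sym (1/ℕ-*-ιₙ-* n a)) (trans (cong (1/ℕ (suc n) *_) eq) (1/ℕ-*-ιₙ-* n b))

*-1/ℕ-cross : ∀ p q {a b} → ιₙ (suc q) * a ≡ ιₙ (suc p) * b → a * 1/ℕ (suc p) ≡ b * 1/ℕ (suc q)
*-1/ℕ-cross p q {a} {b} eq = begin
  a * 1/ℕ (suc p)                                ≡⟨ ℚ.*-identityʳ _ ⟨
  a * 1/ℕ (suc p) * 1ℚ                           ≡⟨ cong (a * 1/ℕ (suc p) *_) (ιₙ-*-1/ℕ q) ⟨
  a * 1/ℕ (suc p) * (ιₙ (suc q) * 1/ℕ (suc q))   ≡⟨ regroup a (1/ℕ (suc p)) (ιₙ (suc q)) (1/ℕ (suc q)) ⟩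
  ιₙ (suc q) * a * 1/ℕ (suc p) * 1/ℕ (suc q)     ≡⟨ cong (λ c → c * 1/ℕ (suc p) * 1/ℕ (suc q)) eq ⟩
  ιₙ (suc p) * b * 1/ℕ (suc p) * 1/ℕ (suc q)     ≡⟨ regroup′ (ιₙ (suc p)) b (1/ℕ (suc p)) (1/ℕ (suc q)) ⟩
  b * 1/ℕ (suc q) * (ιₙ (suc p) * 1/ℕ (suc p))   ≡⟨ cong (b * 1/ℕ (suc q) *_) (ιₙ-*-1/ℕ p) ⟩
  b * 1/ℕ (suc q) * 1ℚ                           ≡⟨ ℚ.*-identityʳ _ ⟩
  b * 1/ℕ (suc q)                                ∎
  where
  regroup : ∀ a w c v → a * w * (c * v) ≡ c * a * w * v
  regroup = solve-∀ ℚ-ring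
  regroup′ : ∀ c b w v → c * b * w * v ≡ b * v * (c * w)
  regroup′ = solve-∀ ℚ-ring

∑ : ℕ → (ℕ → ℚ) → ℚ
∑ n f = sum {n} (f ∘ toℕ)

-- Σ[ i < n ] e sums e over i = 0 … n-1; its body extends over _*_ but not over _+_.
infix 6.5 ∑
syntax ∑ n (λ i → e) = Σ[ i < n ] e

Σ-cong : ∀ n {f g : ℕ → ℚ} → (∀ i → i < n → f i ≡ g i) → Σ[ i < n ] f i ≡ Σ[ i < n ] g i
Σ-cong n f≡g = sum-cong-≗ (λ i → f≡g (toℕ i) (toℕ<n i))

Σ-cong′ : ∀ n {f g : ℕ → ℚ} → (∀ i → f i ≡ g i) → Σ[ i < n ] f i ≡ Σ[ i < n ] g i
Σ-cong′ n f≡g = Σ-cong n (λ i _ → f≡g i)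

Σ-zero : ∀ n {f : ℕ → ℚ} → (∀ i → i < n → f i ≡ 0ℚ) → Σ[ i < n ] f i ≡ 0ℚ
Σ-zero n f≡0 = trans (Σ-cong n f≡0) (sum-replicate-zero n)

Σ-+ : ∀ n (f g : ℕ → ℚ) → Σ[ i < n ] (f i + g i) ≡ Σ[ i < n ] f i + Σ[ i < n ] g i
Σ-+ n f g = ∑-distrib-+ {n} (f ∘ toℕ) (g ∘ toℕ)

Σ-*ˡ : ∀ n c (f : ℕ → ℚ) → Σ[ i < n ] (c * f i) ≡ c * (Σ[ i < n ] f i)
Σ-*ˡ n c f = sym (*-distribˡ-sum {n} c (f ∘ toℕ))

Σ-*ʳ : ∀ n c (f : ℕ → ℚ) → Σ[ i < n ] (f i * c) ≡ (Σ[ i < n ] f i) * c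
Σ-*ʳ n c f = sym (*-distribʳ-sum {n} c (f ∘ toℕ))

Σ-comm : ∀ m n (f : ℕ → ℕ → ℚ) → Σ[ i < m ] Σ[ j < n ] f i j ≡ Σ[ j < n ] Σ[ i < m ] f i j
Σ-comm m n f = ∑-comm {m} {n} (λ i j → f (toℕ i) (toℕ j))

Σ-last : ∀ n (f : ℕ → ℚ) → Σ[ i < suc n ] f i ≡ Σ[ i < n ] f i + f n
Σ-last n f = trans (sum-init-last {n} (f ∘ toℕ))
  (cong₂ _+_ (sum-cong-≗ {n} (cong f ∘ toℕ-inject₁)) (cong f (toℕ-fromℕ n)))

Σ-split : ∀ m n (f : ℕ → ℚ) → Σ[ i < m ℕ.+ n ] f i ≡ Σ[ i < m ] f i + Σ[ j < n ] f (m ℕ.+ j)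
Σ-split zero    n f = sym (ℚ.+-identityˡ _)
Σ-split (suc m) n f = trans (cong (f 0 +_) (Σ-split m n (f ∘ suc))) (sym (ℚ.+-assoc (f 0) _ _))

Σ-extend : ∀ {n M} (f : ℕ → ℚ) → n ≤ M → (∀ i → n ≤ i → f i ≡ 0ℚ) → Σ[ i < M ] f i ≡ Σ[ i < n ] f i
Σ-extend {n} {M} f n≤M f≡0 = begin
  Σ[ i < M ] f i                                       ≡⟨ cong (λ m → ∑ m f) (ℕ.m+[n∸m]≡n n≤M) ⟨
  Σ[ i < n ℕ.+ (M ∸ n) ] f i                           ≡⟨ Σ-split n (M ∸ n) f ⟩
  Σ[ i < n ] f i + Σ[ j < M ∸ n ] f (n ℕ.+ j)          ≡⟨ cong (Σ[ i < n ] f i +_) (Σ-zero (M ∸ n) (λ j _ → f≡0 (n ℕ.+ j) (ℕ.m≤m+n n j))) ⟩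
  Σ[ i < n ] f i + 0ℚ                                  ≡⟨ ℚ.+-identityʳ _ ⟩
  Σ[ i < n ] f i                                       ∎

Σ-telescope : ∀ n (g : ℕ → ℚ) → Σ[ i < n ] (g (suc i) - g i) ≡ g n - g 0
Σ-telescope zero    g = sym (ℚ.+-inverseʳ (g 0))
Σ-telescope (suc n) g = trans (cong (g 1 - g 0 +_) (Σ-telescope n (g ∘ suc))) (collapse (g 0) (g 1) (g (suc n)))
  where
  collapse : ∀ a b c → (b - a) + (c - b) ≡ c - a
  collapse = solve-∀ ℚ-ring

δ-refl : ∀ m → δ m m ≡ 1ℚ
δ-refl m with m ℕ.≟ m
... | yes _   = refl
... | no m≢m = ⊥-elim (m≢m refl)

δ-≢ : ∀ {m k} → m ≢ k → δ m k ≡ 0ℚ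
δ-≢ {m} {k} m≢k with m ℕ.≟ k
... | yes m≡k = ⊥-elim (m≢k m≡k)
... | no _    = refl

δ-suc : ∀ m k → δ (suc m) (suc k) ≡ δ m k
δ-suc m k with m ℕ.≟ k
... | yes refl = δ-refl (suc m)
... | no m≢k   = δ-≢ (m≢k ∘ ℕ.suc-injective)

Σ-δ : ∀ M (f : ℕ → ℚ) k → (∀ m → M ≤ m → f m ≡ 0ℚ) → Σ[ m < M ] f m * δ m k ≡ f k
Σ-δ zero    f k       f≡0 = sym (f≡0 k z≤n)
Σ-δ (suc M) f zero    f≡0 = begin
  f 0 * 1ℚ + Σ[ m < M ] f (suc m) * 0ℚ     ≡⟨ cong₂ _+_ (ℚ.*-identityʳ (f 0)) (Σ-zero M (λ m _ → ℚ.*-zeroʳ (f (suc m)))) ⟩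
  f 0 + 0ℚ                                 ≡⟨ ℚ.+-identityʳ (f 0) ⟩
  f 0                                      ∎
Σ-δ (suc M) f (suc k) f≡0 = begin
  f 0 * 0ℚ + Σ[ m < M ] f (suc m) * δ (suc m) (suc k)  ≡⟨ cong₂ _+_ (ℚ.*-zeroʳ (f 0)) (Σ-cong′ M (λ m → cong (f (suc m) *_) (δ-suc m k))) ⟩
  0ℚ + Σ[ m < M ] f (suc m) * δ m k                    ≡⟨ ℚ.+-identityˡ _ ⟩
  Σ[ m < M ] f (suc m) * δ m k                         ≡⟨ Σ-δ M (f ∘ suc) k (λ m M≤m → f≡0 (suc m) (s≤s M≤m)) ⟩
  f (suc k)                                            ∎

-- Σ[ a to b ] f unfolds to a loop running over suc b ∸ a indices, so abstracting that
-- length makes it compute.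
Σ-to-empty : ∀ {a b} (f : ℕ → ℚ) → b < a → Σ[ a to b ] f ≡ 0ℚ
Σ-to-empty {a} {b} f b<a with suc b ∸ a | ℕ.m≤n⇒m∸n≡0 b<a
... | .0 | refl = refl

Σ-to-step : ∀ {a b} (f : ℕ → ℚ) → a ≤ b → Σ[ a to b ] f ≡ f a + Σ[ suc a to b ] f
Σ-to-step {a} {b} f a≤b with suc b ∸ a | ℕ.+-∸-assoc 1 a≤b
... | .(suc (b ∸ a)) | refl = refl

Σ-to-of-length : ∀ d a b (f : ℕ → ℚ) → suc b ∸ a ≡ d → Σ[ a to b ] f ≡ Σ[ j < d ] f (a ℕ.+ j)
Σ-to-of-length zero    a b f len = Σ-to-empty {a} {b} f (ℕ.m∸n≡0⇒m≤n len)
Σ-to-of-length (suc d) a b f len = begin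
  Σ[ a to b ] f                                ≡⟨ Σ-to-step {a} {b} f a≤b ⟩
  f a + Σ[ suc a to b ] f                      ≡⟨ cong₂ _+_ (cong f (sym (ℕ.+-identityʳ a))) (Σ-to-of-length d (suc a) b f len′) ⟩
  f (a ℕ.+ 0) + Σ[ j < d ] f (suc a ℕ.+ j)     ≡⟨ cong (f (a ℕ.+ 0) +_) (Σ-cong′ d (λ j → cong f (ℕ.+-suc a j))) ⟨
  Σ[ j < suc d ] f (a ℕ.+ j)                   ∎
  where
  a≤b : a ≤ b
  a≤b = ℕ.≤-pred (ℕ.m∸n≢0⇒n<m (λ len0 → ℕ.0≢1+n (trans (sym len0) len)))
  len′ : suc b ∸ suc a ≡ d
  len′ = ℕ.suc-injective (trans (sym (ℕ.+-∸-assoc 1 a≤b)) len)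

Σ-to≡Σ< : ∀ {a b} (f : ℕ → ℚ) → a ≤ suc b → (∀ i → i < a → f i ≡ 0ℚ) → Σ[ a to b ] f ≡ Σ[ i < suc b ] f i
Σ-to≡Σ< {a} {b} f a≤1+b f≡0 = begin
  Σ[ a to b ] f                                      ≡⟨ Σ-to-of-length (suc b ∸ a) a b f refl ⟩
  Σ[ j < suc b ∸ a ] f (a ℕ.+ j)                     ≡⟨ ℚ.+-identityˡ _ ⟨
  0ℚ + Σ[ j < suc b ∸ a ] f (a ℕ.+ j)                ≡⟨ cong (_+ Σ[ j < suc b ∸ a ] f (a ℕ.+ j)) (Σ-zero a f≡0) ⟨
  Σ[ i < a ] f i + Σ[ j < suc b ∸ a ] f (a ℕ.+ j)    ≡⟨ Σ-split a (suc b ∸ a) f ⟨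
  Σ[ i < a ℕ.+ (suc b ∸ a) ] f i                     ≡⟨ cong (λ n → ∑ n f) (ℕ.m+[n∸m]≡n a≤1+b) ⟩
  Σ[ i < suc b ] f i                                 ∎

[1+n]Cn≡1+n : ∀ n → suc n C n ≡ suc n
[1+n]Cn≡1+n n = trans (nCk≡nC[n∸k] (ℕ.n≤1+n n)) (trans (cong (suc n C_) (ℕ.m+n∸n≡m 1 n)) (nC1≡n (suc n)))

[1+n]*nCm≡[1+m]*[1+n]C[1+m] : ∀ n m → suc n ℕ.* (n C m) ≡ suc m ℕ.* (suc n C suc m)
[1+n]*nCm≡[1+m]*[1+n]C[1+m] zero    zero    = refl
[1+n]*nCm≡[1+m]*[1+n]C[1+m] zero    (suc m) = sym (ℕ.*-zeroʳ (suc (suc m)))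
[1+n]*nCm≡[1+m]*[1+n]C[1+m] (suc n) zero    = trans (ℕ.*-identityʳ (suc (suc n))) (sym (trans (ℕ.+-identityʳ _) (nC1≡n (suc (suc n)))))
[1+n]*nCm≡[1+m]*[1+n]C[1+m] (suc n) (suc m) = begin
  suc (suc n) ℕ.* (suc n C suc m)                               ≡⟨ cong (suc (suc n) ℕ.*_) (nCk+nC[k+1]≡[n+1]C[k+1] n m) ⟨
  suc (suc n) ℕ.* (c₁ ℕ.+ c₂)                                   ≡⟨ split n c₁ c₂ ⟩
  (suc n ℕ.* c₁ ℕ.+ suc n ℕ.* c₂) ℕ.+ (c₁ ℕ.+ c₂)               ≡⟨ cong₂ (λ u v → (u ℕ.+ v) ℕ.+ (c₁ ℕ.+ c₂)) ([1+n]*nCm≡[1+m]*[1+n]C[1+m] n m) ([1+n]*nCm≡[1+m]*[1+n]C[1+m] n (suc m)) ⟩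
  (suc m ℕ.* c₃ ℕ.+ suc (suc m) ℕ.* c₄) ℕ.+ (c₁ ℕ.+ c₂)        ≡⟨ cong ((suc m ℕ.* c₃ ℕ.+ suc (suc m) ℕ.* c₄) ℕ.+_) (nCk+nC[k+1]≡[n+1]C[k+1] n m) ⟩
  (suc m ℕ.* c₃ ℕ.+ suc (suc m) ℕ.* c₄) ℕ.+ c₃                  ≡⟨ merge m c₃ c₄ ⟩
  suc (suc m) ℕ.* (c₃ ℕ.+ c₄)                                   ≡⟨ cong (suc (suc m) ℕ.*_) (nCk+nC[k+1]≡[n+1]C[k+1] (suc n) (suc m)) ⟩
  suc (suc m) ℕ.* (suc (suc n) C suc (suc m))                   ∎
  where
  c₁ = n C m
  c₂ = n C suc m
  c₃ = suc n C suc m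
  c₄ = suc n C suc (suc m)
  split : ∀ n a b → suc (suc n) ℕ.* (a ℕ.+ b) ≡ (suc n ℕ.* a ℕ.+ suc n ℕ.* b) ℕ.+ (a ℕ.+ b)
  split = solve-∀ ℕ-ring
  merge : ∀ m a b → (suc m ℕ.* a ℕ.+ suc (suc m) ℕ.* b) ℕ.+ a ≡ suc (suc m) ℕ.* (a ℕ.+ b)
  merge = solve-∀ ℕ-ring

[a+c]C[a+b]*[a+b]Ca≡[a+c]Ca*cCb : ∀ a b c → ((a ℕ.+ c) C (a ℕ.+ b)) ℕ.* ((a ℕ.+ b) C a) ≡ ((a ℕ.+ c) C a) ℕ.* (c C b)
[a+c]C[a+b]*[a+b]Ca≡[a+c]Ca*cCb zero    b c = trans (ℕ.*-identityʳ (c C b)) (sym (ℕ.*-identityˡ (c C b)))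
[a+c]C[a+b]*[a+b]Ca≡[a+c]Ca*cCb (suc a) b c = ℕ.*-cancelˡ-≡ _ _ (p ℕ.* q) (begin
  (p ℕ.* q) ℕ.* ((r C q) ℕ.* (q C p))                      ≡⟨ swap p q (r C q) (q C p) ⟩
  (q ℕ.* (r C q)) ℕ.* (p ℕ.* (q C p))                      ≡⟨ cong₂ ℕ._*_ (absorb (a ℕ.+ c) (a ℕ.+ b)) (absorb (a ℕ.+ b) a) ⟨
  (r ℕ.* X₀) ℕ.* (q ℕ.* Y₀)                                ≡⟨ swap′ r q X₀ Y₀ ⟩
  (r ℕ.* q) ℕ.* (X₀ ℕ.* Y₀)                                ≡⟨ cong ((r ℕ.* q) ℕ.*_) ([a+c]C[a+b]*[a+b]Ca≡[a+c]Ca*cCb a b c) ⟩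
  (r ℕ.* q) ℕ.* (Z₀ ℕ.* (c C b))                           ≡⟨ swap″ r q Z₀ (c C b) ⟩
  q ℕ.* ((r ℕ.* Z₀) ℕ.* (c C b))                           ≡⟨ cong (λ u → q ℕ.* (u ℕ.* (c C b))) (absorb (a ℕ.+ c) a) ⟩
  q ℕ.* ((p ℕ.* (r C p)) ℕ.* (c C b))                      ≡⟨ swap‴ p q (r C p) (c C b) ⟩
  (p ℕ.* q) ℕ.* ((r C p) ℕ.* (c C b))                      ∎)
  where
  p = suc a
  q = suc (a ℕ.+ b)
  r = suc (a ℕ.+ c)
  X₀ = (a ℕ.+ c) C (a ℕ.+ b)
  Y₀ = (a ℕ.+ b) C a
  Z₀ = (a ℕ.+ c) C a
  absorb = [1+n]*nCm≡[1+m]*[1+n]C[1+m]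
  swap : ∀ p q x y → (p ℕ.* q) ℕ.* (x ℕ.* y) ≡ (q ℕ.* x) ℕ.* (p ℕ.* y)
  swap = solve-∀ ℕ-ring
  swap′ : ∀ r q x y → (r ℕ.* x) ℕ.* (q ℕ.* y) ≡ (r ℕ.* q) ℕ.* (x ℕ.* y)
  swap′ = solve-∀ ℕ-ring
  swap″ : ∀ r q x y → (r ℕ.* q) ℕ.* (x ℕ.* y) ≡ q ℕ.* ((r ℕ.* x) ℕ.* y)
  swap″ = solve-∀ ℕ-ring
  swap‴ : ∀ p q x y → q ℕ.* ((p ℕ.* x) ℕ.* y) ≡ (p ℕ.* q) ℕ.* (x ℕ.* y)
  swap‴ = solve-∀ ℕ-ring

Sℚ : ℕ → ℕ → ℚ
Sℚ n k = ιₙ (S n k)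

sℚ : ℕ → ℕ → ℚ
sℚ n k = ι (s n k)

Cℚ : ℕ → ℕ → ℚ
Cℚ n k = ιₙ (n C k)

n<k⇒S[n,k]≡0 : ∀ {n k} → n < k → Sℚ n k ≡ 0ℚ
n<k⇒S[n,k]≡0 n<k = cong ιₙ (vanish n<k)
  where
  vanish : ∀ {n k} → n < k → S n k ≡ 0
  vanish {zero}  {suc k} _         = refl
  vanish {suc n} {suc k} (s≤s n<k) rewrite vanish n<k | vanish (ℕ.m<n⇒m<1+n n<k) = ℕ.*-zeroʳ (suc k)

n<k⇒s[n,k]≡0 : ∀ {n k} → n < k → sℚ n k ≡ 0ℚ
n<k⇒s[n,k]≡0 n<k = cong ι (vanish n<k)
  where
  vanish : ∀ {n k} → n < k → s n k ≡ ℤ.+ 0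
  vanish {zero}  {suc k} _         = refl
  vanish {suc n} {suc k} (s≤s n<k) rewrite vanish n<k | vanish (ℕ.m<n⇒m<1+n n<k) = cong (ℤ._-_ ℤ.0ℤ) (ℤ.*-zeroʳ (ℤ.+ n))

n<k⇒C[n,k]≡0 : ∀ {n k} → n < k → Cℚ n k ≡ 0ℚ
n<k⇒C[n,k]≡0 n<k = cong ιₙ (k>n⇒nCk≡0 n<k)

S-suc-suc : ∀ n k → Sℚ (suc n) (suc k) ≡ Sℚ n k + ιₙ (suc k) * Sℚ n (suc k)
S-suc-suc n k = trans (ιₙ-+ (S n k) (suc k ℕ.* S n (suc k))) (cong (Sℚ n k +_) (ιₙ-* (suc k) (S n (suc k))))

s-suc-suc : ∀ n k → sℚ (suc n) (suc k) ≡ sℚ n k - ιₙ n * sℚ n (suc k)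
s-suc-suc n k = trans (ι-+ (s n k) (ℤ.- (ℤ.+ n ℤ.* s n (suc k)))) (cong (sℚ n k +_) (trans (ι-neg (ℤ.+ n ℤ.* s n (suc k))) (cong -_ (ι-* (ℤ.+ n) (s n (suc k))))))

C-suc-suc : ∀ n k → Cℚ (suc n) (suc k) ≡ Cℚ n k + Cℚ n (suc k)
C-suc-suc n k = trans (cong ιₙ (sym (nCk+nC[k+1]≡[n+1]C[k+1] n k))) (ιₙ-+ (n C k) (n C suc k))

-- After expanding both recurrences the cross terms telescope, with g j = j S(n,j) s(j,k+1).
ΣS[n,i]s[i,k]≡δ[n,k] : ∀ n k → Σ[ i < suc n ] Sℚ n i * sℚ i k ≡ δ n k
ΣS[n,i]s[i,k]≡δ[n,k] zero    zero    = refl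
ΣS[n,i]s[i,k]≡δ[n,k] zero    (suc k) = refl
ΣS[n,i]s[i,k]≡δ[n,k] (suc n) zero    = trans (ℚ.+-identityˡ _) (Σ-zero (suc n) (λ i _ → ℚ.*-zeroʳ (Sℚ (suc n) (suc i))))
ΣS[n,i]s[i,k]≡δ[n,k] (suc n) (suc k) = begin
  Σ[ i < suc (suc n) ] Sℚ (suc n) i * sℚ i (suc k)                       ≡⟨ ℚ.+-identityˡ _ ⟩
  Σ[ i < suc n ] Sℚ (suc n) (suc i) * sℚ (suc i) (suc k)                 ≡⟨ Σ-cong′ (suc n) telescoping ⟩
  Σ[ i < suc n ] (Sℚ n i * sℚ i k + (g (suc i) - g i))                   ≡⟨ Σ-+ (suc n) (λ i → Sℚ n i * sℚ i k) (λ i → g (suc i) - g i) ⟩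
  Σ[ i < suc n ] Sℚ n i * sℚ i k + Σ[ i < suc n ] (g (suc i) - g i)      ≡⟨ cong₂ _+_ (ΣS[n,i]s[i,k]≡δ[n,k] n k) (Σ-telescope (suc n) g) ⟩
  δ n k + (g (suc n) - g 0)                                              ≡⟨ cong (δ n k +_) boundary ⟩
  δ n k + 0ℚ                                                             ≡⟨ ℚ.+-identityʳ (δ n k) ⟩
  δ n k                                                                  ≡⟨ δ-suc n k ⟨
  δ (suc n) (suc k)                                                      ∎
  where
  g : ℕ → ℚ
  g j = ιₙ j * Sℚ n j * sℚ j (suc k)
  boundary : g (suc n) - g 0 ≡ 0ℚ
  boundary = begin
    g (suc n) - g 0                                        ≡⟨ cong (λ x → ιₙ (suc n) * x * sℚ (suc n) (suc k) - g 0) (n<k⇒S[n,k]≡0 (ℕ.n<1+n n)) ⟩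
    ιₙ (suc n) * 0ℚ * sℚ (suc n) (suc k) - 0ℚ * Sℚ n 0 * 0ℚ ≡⟨ vanishing (ιₙ (suc n)) (sℚ (suc n) (suc k)) (Sℚ n 0) ⟩
    0ℚ                                                     ∎
    where
    vanishing : ∀ a b c → a * 0ℚ * b - 0ℚ * c * 0ℚ ≡ 0ℚ
    vanishing = solve-∀ ℚ-ring
  telescoping : ∀ i → Sℚ (suc n) (suc i) * sℚ (suc i) (suc k) ≡ Sℚ n i * sℚ i k + (g (suc i) - g i)
  telescoping i = begin
    Sℚ (suc n) (suc i) * sℚ (suc i) (suc k)                                  ≡⟨ cong (_* sℚ (suc i) (suc k)) (S-suc-suc n i) ⟩
    (Sℚ n i + ιₙ (suc i) * Sℚ n (suc i)) * sℚ (suc i) (suc k)                ≡⟨ distrib (Sℚ n i) (ιₙ (suc i)) (Sℚ n (suc i)) (sℚ (suc i) (suc k)) ⟩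
    Sℚ n i * sℚ (suc i) (suc k) + g (suc i)                                  ≡⟨ cong (λ x → Sℚ n i * x + g (suc i)) (s-suc-suc i k) ⟩
    Sℚ n i * (sℚ i k - ιₙ i * sℚ i (suc k)) + g (suc i)                      ≡⟨ regroup (Sℚ n i) (sℚ i k) (ιₙ i) (sℚ i (suc k)) (g (suc i)) ⟩
    Sℚ n i * sℚ i k + (g (suc i) - g i)                                      ∎
    where
    distrib : ∀ a c b x → (a + c * b) * x ≡ a * x + c * b * x
    distrib = solve-∀ ℚ-ring
    regroup : ∀ a y c z h → a * (y - c * z) + h ≡ a * y + (h - c * a * z)
    regroup = solve-∀ ℚ-ring

Σ-pascal : ∀ N (f : ℕ → ℚ) →
  Σ[ m < suc (suc N) ] Cℚ (suc N) m * f m ≡ Σ[ m < suc N ] Cℚ N m * f (suc m) + Σ[ m < suc N ] Cℚ N m * f m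
Σ-pascal N f = begin
  1ℚ * f 0 + Σ[ m < suc N ] Cℚ (suc N) (suc m) * f (suc m)      ≡⟨ cong (1ℚ * f 0 +_) pascal ⟩
  1ℚ * f 0 + (shifted + upper)                                   ≡⟨ swap (1ℚ * f 0) shifted upper ⟩
  shifted + Σ[ m < suc (suc N) ] Cℚ N m * f m                    ≡⟨ cong (shifted +_) top ⟩
  shifted + Σ[ m < suc N ] Cℚ N m * f m                          ∎
  where
  shifted upper : ℚ
  shifted = Σ[ m < suc N ] Cℚ N m * f (suc m)
  upper   = Σ[ m < suc N ] Cℚ N (suc m) * f (suc m)
  swap : ∀ a b c → a + (b + c) ≡ b + (a + c)
  swap = solve-∀ ℚ-ring
  pascal : Σ[ m < suc N ] Cℚ (suc N) (suc m) * f (suc m) ≡ shifted + upper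
  pascal = trans (Σ-cong′ (suc N) (λ m → trans (cong (_* f (suc m)) (C-suc-suc N m)) (ℚ.*-distribʳ-+ (f (suc m)) (Cℚ N m) (Cℚ N (suc m)))))
                 (Σ-+ (suc N) (λ m → Cℚ N m * f (suc m)) (λ m → Cℚ N (suc m) * f (suc m)))
  top : Σ[ m < suc (suc N) ] Cℚ N m * f m ≡ Σ[ m < suc N ] Cℚ N m * f m
  top = Σ-extend (λ m → Cℚ N m * f m) (ℕ.n≤1+n (suc N))
          (λ m N<m → trans (cong (_* f m) (n<k⇒C[n,k]≡0 N<m)) (ℚ.*-zeroˡ (f m)))

Σ-S-suc-suc : ∀ M (c : ℕ → ℚ) j →
  Σ[ m < M ] c m * Sℚ (suc m) (suc j) ≡ Σ[ m < M ] c m * Sℚ m j + ιₙ (suc j) * (Σ[ m < M ] c m * Sℚ m (suc j))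
Σ-S-suc-suc M c j = begin
  Σ[ m < M ] c m * Sℚ (suc m) (suc j)                                        ≡⟨ Σ-cong′ M (λ m → trans (cong (c m *_) (S-suc-suc m j)) (expand (c m) (Sℚ m j) (ιₙ (suc j)) (Sℚ m (suc j)))) ⟩
  Σ[ m < M ] (c m * Sℚ m j + ιₙ (suc j) * (c m * Sℚ m (suc j)))              ≡⟨ Σ-+ M (λ m → c m * Sℚ m j) (λ m → ιₙ (suc j) * (c m * Sℚ m (suc j))) ⟩
  Σ[ m < M ] c m * Sℚ m j + Σ[ m < M ] ιₙ (suc j) * (c m * Sℚ m (suc j))    ≡⟨ cong (Σ[ m < M ] c m * Sℚ m j +_) (Σ-*ˡ M (ιₙ (suc j)) (λ m → c m * Sℚ m (suc j))) ⟩
  Σ[ m < M ] c m * Sℚ m j + ιₙ (suc j) * (Σ[ m < M ] c m * Sℚ m (suc j))    ∎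
  where
  expand : ∀ c a i b → c * (a + i * b) ≡ c * a + i * (c * b)
  expand = solve-∀ ℚ-ring

ΣC[N,m]S[m,j]≡S[N+1,j+1] : ∀ N j → Σ[ m < suc N ] Cℚ N m * Sℚ m j ≡ Sℚ (suc N) (suc j)
ΣC[N,m]S[m+1,j]≡S[N+1,j]+jS[N+1,j+1] : ∀ N j →
  Σ[ m < suc N ] Cℚ N m * Sℚ (suc m) j ≡ Sℚ (suc N) j + ιₙ j * Sℚ (suc N) (suc j)

ΣC[N,m]S[m,j]≡S[N+1,j+1] zero    zero    = refl
ΣC[N,m]S[m,j]≡S[N+1,j+1] zero    (suc j) = cong ιₙ (sym (ℕ.*-zeroʳ (suc (suc j))))
ΣC[N,m]S[m,j]≡S[N+1,j+1] (suc N) j = begin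
  Σ[ m < suc (suc N) ] Cℚ (suc N) m * Sℚ m j                                        ≡⟨ Σ-pascal N (λ m → Sℚ m j) ⟩
  Σ[ m < suc N ] Cℚ N m * Sℚ (suc m) j + Σ[ m < suc N ] Cℚ N m * Sℚ m j             ≡⟨ cong₂ _+_ (ΣC[N,m]S[m+1,j]≡S[N+1,j]+jS[N+1,j+1] N j) (ΣC[N,m]S[m,j]≡S[N+1,j+1] N j) ⟩
  (Sℚ (suc N) j + ιₙ j * Sℚ (suc N) (suc j)) + Sℚ (suc N) (suc j)                   ≡⟨ collect (Sℚ (suc N) j) (ιₙ j) (Sℚ (suc N) (suc j)) ⟩
  Sℚ (suc N) j + (1ℚ + ιₙ j) * Sℚ (suc N) (suc j)                                   ≡⟨ cong (λ x → Sℚ (suc N) j + x * Sℚ (suc N) (suc j)) (ιₙ-+ 1 j) ⟨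
  Sℚ (suc N) j + ιₙ (suc j) * Sℚ (suc N) (suc j)                                    ≡⟨ S-suc-suc (suc N) j ⟨
  Sℚ (suc (suc N)) (suc j)                                                          ∎
  where
  collect : ∀ a i b → (a + i * b) + b ≡ a + (1ℚ + i) * b
  collect = solve-∀ ℚ-ring

ΣC[N,m]S[m+1,j]≡S[N+1,j]+jS[N+1,j+1] N zero = begin
  Σ[ m < suc N ] Cℚ N m * 0ℚ             ≡⟨ Σ-zero (suc N) (λ m _ → ℚ.*-zeroʳ (Cℚ N m)) ⟩
  0ℚ                                     ≡⟨ ℚ.*-zeroˡ (Sℚ (suc N) 1) ⟨
  0ℚ * Sℚ (suc N) 1                      ≡⟨ ℚ.+-identityˡ _ ⟨
  0ℚ + 0ℚ * Sℚ (suc N) 1                 ∎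
ΣC[N,m]S[m+1,j]≡S[N+1,j]+jS[N+1,j+1] N (suc j) = begin
  Σ[ m < suc N ] Cℚ N m * Sℚ (suc m) (suc j)                                                      ≡⟨ Σ-S-suc-suc (suc N) (Cℚ N) j ⟩
  Σ[ m < suc N ] Cℚ N m * Sℚ m j + ιₙ (suc j) * (Σ[ m < suc N ] Cℚ N m * Sℚ m (suc j))            ≡⟨ cong₂ (λ x y → x + ιₙ (suc j) * y) (ΣC[N,m]S[m,j]≡S[N+1,j+1] N j) (ΣC[N,m]S[m,j]≡S[N+1,j+1] N (suc j)) ⟩
  Sℚ (suc N) (suc j) + ιₙ (suc j) * Sℚ (suc N) (suc (suc j))                                     ∎

ΣS[N+1,i+1]s[i,k]≡C[N,k] : ∀ N k → Σ[ i < suc (suc N) ] Sℚ (suc N) (suc i) * sℚ i k ≡ Cℚ N k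
ΣS[N+1,i+1]s[i,k]≡C[N,k] N k = begin
  Σ[ i < suc (suc N) ] Sℚ (suc N) (suc i) * sℚ i k                               ≡⟨ Σ-cong′ (suc (suc N)) expand ⟨
  Σ[ i < suc (suc N) ] Σ[ m < suc N ] Cℚ N m * (Sℚ m i * sℚ i k)                 ≡⟨ Σ-comm (suc (suc N)) (suc N) (λ i m → Cℚ N m * (Sℚ m i * sℚ i k)) ⟩
  Σ[ m < suc N ] Σ[ i < suc (suc N) ] Cℚ N m * (Sℚ m i * sℚ i k)                 ≡⟨ Σ-cong (suc N) orthogonality ⟩
  Σ[ m < suc N ] Cℚ N m * δ m k                                                  ≡⟨ Σ-δ (suc N) (Cℚ N) k (λ m N<m → n<k⇒C[n,k]≡0 N<m) ⟩
  Cℚ N k                                                                         ∎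
  where
  expand : ∀ i → Σ[ m < suc N ] Cℚ N m * (Sℚ m i * sℚ i k) ≡ Sℚ (suc N) (suc i) * sℚ i k
  expand i = begin
    Σ[ m < suc N ] Cℚ N m * (Sℚ m i * sℚ i k)       ≡⟨ Σ-cong′ (suc N) (λ m → ℚ.*-assoc (Cℚ N m) (Sℚ m i) (sℚ i k)) ⟨
    Σ[ m < suc N ] Cℚ N m * Sℚ m i * sℚ i k         ≡⟨ Σ-*ʳ (suc N) (sℚ i k) (λ m → Cℚ N m * Sℚ m i) ⟩
    (Σ[ m < suc N ] Cℚ N m * Sℚ m i) * sℚ i k       ≡⟨ cong (_* sℚ i k) (ΣC[N,m]S[m,j]≡S[N+1,j+1] N i) ⟩
    Sℚ (suc N) (suc i) * sℚ i k                     ∎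
  orthogonality : ∀ m → m < suc N → Σ[ i < suc (suc N) ] Cℚ N m * (Sℚ m i * sℚ i k) ≡ Cℚ N m * δ m k
  orthogonality m m<1+N = begin
    Σ[ i < suc (suc N) ] Cℚ N m * (Sℚ m i * sℚ i k)     ≡⟨ Σ-*ˡ (suc (suc N)) (Cℚ N m) (λ i → Sℚ m i * sℚ i k) ⟩
    Cℚ N m * (Σ[ i < suc (suc N) ] Sℚ m i * sℚ i k)     ≡⟨ cong (Cℚ N m *_) (Σ-extend (λ i → Sℚ m i * sℚ i k) (ℕ.m≤n⇒m≤1+n m<1+N) vanish) ⟩
    Cℚ N m * (Σ[ i < suc m ] Sℚ m i * sℚ i k)           ≡⟨ cong (Cℚ N m *_) (ΣS[n,i]s[i,k]≡δ[n,k] m k) ⟩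
    Cℚ N m * δ m k                                       ∎
    where
    vanish : ∀ i → suc m ≤ i → Sℚ m i * sℚ i k ≡ 0ℚ
    vanish i m<i = trans (cong (_* sℚ i k) (n<k⇒S[n,k]≡0 m<i)) (ℚ.*-zeroˡ (sℚ i k))

BinomialRecurrence : (ℕ → ℚ) → (ℕ → ℚ) → Set
BinomialRecurrence c x = ∀ N → Σ[ m < N ] Cℚ N m * x m ≡ c N

Σ-last-C : ∀ N (x : ℕ → ℚ) → Σ[ m < suc N ] Cℚ N m * x m ≡ Σ[ m < N ] Cℚ N m * x m + x N
Σ-last-C N x = trans (Σ-last N (λ m → Cℚ N m * x m))
  (cong (Σ[ m < N ] Cℚ N m * x m +_) (trans (cong (λ c → ιₙ c * x N) (nCn≡1 N)) (ℚ.*-identityˡ (x N))))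

binomialRecurrence-unique : ∀ {c x y} → BinomialRecurrence c x → BinomialRecurrence c y → ∀ m → x m ≡ y m
binomialRecurrence-unique {x = x} {y = y} x-rec y-rec = <-rec (λ m → x m ≡ y m) agree
  where
  last : ∀ N z → Σ[ j < suc N ] Cℚ (suc N) j * z j ≡ Σ[ j < N ] Cℚ (suc N) j * z j + ιₙ (suc N) * z N
  last N z = trans (Σ-last N (λ j → Cℚ (suc N) j * z j)) (cong (λ c → Σ[ j < N ] Cℚ (suc N) j * z j + ιₙ c * z N) ([1+n]Cn≡1+n N))
  agree : ∀ N → (∀ {m} → m < N → x m ≡ y m) → x N ≡ y N
  agree N earlier = ιₙ-suc-*-cancelˡ N (∙-cancelˡ (Σ[ j < N ] Cℚ (suc N) j * x j) (ιₙ (suc N) * x N) (ιₙ (suc N) * y N) (begin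
    Σ[ j < N ] Cℚ (suc N) j * x j + ιₙ (suc N) * x N    ≡⟨ last N x ⟨
    Σ[ j < suc N ] Cℚ (suc N) j * x j                   ≡⟨ trans (x-rec (suc N)) (sym (y-rec (suc N))) ⟩
    Σ[ j < suc N ] Cℚ (suc N) j * y j                   ≡⟨ last N y ⟩
    Σ[ j < N ] Cℚ (suc N) j * y j + ιₙ (suc N) * y N    ≡⟨ cong (_+ ιₙ (suc N) * y N) (Σ-cong N (λ j j<N → cong (Cℚ (suc N) j *_) (earlier j<N))) ⟨
    Σ[ j < N ] Cℚ (suc N) j * x j + ιₙ (suc N) * y N    ∎))

ΣSs/i : ℕ → ℕ → ℚ
ΣSs/i k n = Σ[ i < suc n ] Sℚ n i * sℚ i k * 1/ℕ i

-- The factor i of S(N+1,i+1) cancels the weight 1/i; at i = 0 both sides vanish as k ≥ 1.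
ΣC[N,m]S[m+1,i]s[i,k]/i : ∀ N K i →
  Σ[ m < suc N ] Cℚ N m * (Sℚ (suc m) i * sℚ i (suc K) * 1/ℕ i)
    ≡ Sℚ (suc N) i * sℚ i (suc K) * 1/ℕ i + Sℚ (suc N) (suc i) * sℚ i (suc K)
ΣC[N,m]S[m+1,i]s[i,k]/i N K zero =
  trans (Σ-zero (suc N) (λ m _ → ℚ.*-zeroʳ (Cℚ N m))) (sym (trans (ℚ.+-identityˡ _) (ℚ.*-zeroʳ (Sℚ (suc N) 1))))
ΣC[N,m]S[m+1,i]s[i,k]/i N K (suc i) = begin
  Σ[ m < suc N ] Cℚ N m * (Sℚ (suc m) (suc i) * s′ * w)          ≡⟨ Σ-cong′ (suc N) (λ m → regroup (Cℚ N m) (Sℚ (suc m) (suc i)) s′ w) ⟩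
  Σ[ m < suc N ] Cℚ N m * Sℚ (suc m) (suc i) * (s′ * w)          ≡⟨ Σ-*ʳ (suc N) (s′ * w) (λ m → Cℚ N m * Sℚ (suc m) (suc i)) ⟩
  (Σ[ m < suc N ] Cℚ N m * Sℚ (suc m) (suc i)) * (s′ * w)        ≡⟨ cong (_* (s′ * w)) (ΣC[N,m]S[m+1,j]≡S[N+1,j]+jS[N+1,j+1] N (suc i)) ⟩
  (Sℚ (suc N) (suc i) + ιₙ (suc i) * Sℚ (suc N) (suc (suc i))) * (s′ * w)
    ≡⟨ expand (Sℚ (suc N) (suc i)) (ιₙ (suc i)) (Sℚ (suc N) (suc (suc i))) s′ w ⟩
  Sℚ (suc N) (suc i) * s′ * w + Sℚ (suc N) (suc (suc i)) * s′ * (ιₙ (suc i) * w)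
    ≡⟨ cong (λ c → Sℚ (suc N) (suc i) * s′ * w + Sℚ (suc N) (suc (suc i)) * s′ * c) (ιₙ-*-1/ℕ i) ⟩
  Sℚ (suc N) (suc i) * s′ * w + Sℚ (suc N) (suc (suc i)) * s′ * 1ℚ
    ≡⟨ cong (Sℚ (suc N) (suc i) * s′ * w +_) (ℚ.*-identityʳ _) ⟩
  Sℚ (suc N) (suc i) * s′ * w + Sℚ (suc N) (suc (suc i)) * s′    ∎
  where
  s′ = sℚ (suc i) (suc K)
  w  = 1/ℕ (suc i)
  regroup : ∀ c a s w → c * (a * s * w) ≡ c * a * (s * w)
  regroup = solve-∀ ℚ-ring
  expand : ∀ a c b s w → (a + c * b) * (s * w) ≡ a * s * w + b * s * (c * w)
  expand = solve-∀ ℚ-ring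

ΣC[N,m]ΣSs/i[m+1]≡ΣSs/i[N+1]+C[N,k] : ∀ N K →
  Σ[ m < suc N ] Cℚ N m * ΣSs/i (suc K) (suc m) ≡ ΣSs/i (suc K) (suc N) + Cℚ N (suc K)
ΣC[N,m]ΣSs/i[m+1]≡ΣSs/i[N+1]+C[N,k] N K = begin
  Σ[ m < suc N ] Cℚ N m * ΣSs/i k (suc m)                             ≡⟨ Σ-cong (suc N) (λ m m<1+N → cong (Cℚ N m *_) (extend m m<1+N)) ⟩
  Σ[ m < suc N ] Cℚ N m * (Σ[ i < suc (suc N) ] t m i)                ≡⟨ Σ-cong′ (suc N) (λ m → Σ-*ˡ (suc (suc N)) (Cℚ N m) (t m)) ⟨
  Σ[ m < suc N ] Σ[ i < suc (suc N) ] Cℚ N m * t m i                  ≡⟨ Σ-comm (suc N) (suc (suc N)) (λ m i → Cℚ N m * t m i) ⟩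
  Σ[ i < suc (suc N) ] Σ[ m < suc N ] Cℚ N m * t m i                  ≡⟨ Σ-cong′ (suc (suc N)) (ΣC[N,m]S[m+1,i]s[i,k]/i N K) ⟩
  Σ[ i < suc (suc N) ] (Sℚ (suc N) i * sℚ i k * 1/ℕ i + Sℚ (suc N) (suc i) * sℚ i k)
    ≡⟨ Σ-+ (suc (suc N)) (λ i → Sℚ (suc N) i * sℚ i k * 1/ℕ i) (λ i → Sℚ (suc N) (suc i) * sℚ i k) ⟩
  ΣSs/i k (suc N) + Σ[ i < suc (suc N) ] Sℚ (suc N) (suc i) * sℚ i k  ≡⟨ cong (ΣSs/i k (suc N) +_) (ΣS[N+1,i+1]s[i,k]≡C[N,k] N k) ⟩
  ΣSs/i k (suc N) + Cℚ N k                                            ∎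
  where
  k = suc K
  t : ℕ → ℕ → ℚ
  t m i = Sℚ (suc m) i * sℚ i k * 1/ℕ i
  extend : ∀ m → m < suc N → ΣSs/i k (suc m) ≡ Σ[ i < suc (suc N) ] t m i
  extend m m<1+N = sym (Σ-extend (t m) (s≤s m<1+N)
    (λ i m+1<i → trans (cong (λ a → a * sℚ i k * 1/ℕ i) (n<k⇒S[n,k]≡0 m+1<i)) (vanishing (sℚ i k) (1/ℕ i))))
    where
    vanishing : ∀ a b → 0ℚ * a * b ≡ 0ℚ
    vanishing = solve-∀ ℚ-ring

ΣSs/i-binomialRecurrence : ∀ K → BinomialRecurrence (λ N → Cℚ N (suc K)) (λ m → ΣSs/i (suc K) (suc m))
ΣSs/i-binomialRecurrence K N = ∙-cancelʳ (x N) (Σ[ m < N ] Cℚ N m * x m) (Cℚ N (suc K)) (begin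
  Σ[ m < N ] Cℚ N m * x m + x N           ≡⟨ Σ-last-C N x ⟨
  Σ[ m < suc N ] Cℚ N m * x m             ≡⟨ ΣC[N,m]ΣSs/i[m+1]≡ΣSs/i[N+1]+C[N,k] N K ⟩
  x N + Cℚ N (suc K)                      ≡⟨ ℚ.+-comm (x N) (Cℚ N (suc K)) ⟩
  Cℚ N (suc K) + x N                      ∎)
  where
  x : ℕ → ℚ
  x m = ΣSs/i (suc K) (suc m)

length-bernoulliList : ∀ m → length (bernoulliList m) ≡ m
length-bernoulliList zero    = refl
length-bernoulliList (suc m) = trans (length-++ (bernoulliList m)) (trans (ℕ.+-comm _ 1) (cong suc (length-bernoulliList m)))

binomSum-∷ʳ : ∀ N j bs b → binomSum N j (bs ++ [ b ]) ≡ binomSum N j bs + Cℚ N (j ℕ.+ length bs) * b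
binomSum-∷ʳ N j []       b = trans (ℚ.+-identityʳ _) (trans (cong (λ i → Cℚ N i * b) (sym (ℕ.+-identityʳ j))) (sym (ℚ.+-identityˡ _)))
binomSum-∷ʳ N j (c ∷ bs) b = begin
  Cℚ N j * c + binomSum N (suc j) (bs ++ [ b ])                               ≡⟨ cong (Cℚ N j * c +_) (binomSum-∷ʳ N (suc j) bs b) ⟩
  Cℚ N j * c + (binomSum N (suc j) bs + Cℚ N (suc j ℕ.+ length bs) * b)       ≡⟨ ℚ.+-assoc (Cℚ N j * c) (binomSum N (suc j) bs) (Cℚ N (suc j ℕ.+ length bs) * b) ⟨
  Cℚ N j * c + binomSum N (suc j) bs + Cℚ N (suc j ℕ.+ length bs) * b         ≡⟨ cong (λ i → Cℚ N j * c + binomSum N (suc j) bs + Cℚ N i * b) (ℕ.+-suc j (length bs)) ⟨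
  Cℚ N j * c + binomSum N (suc j) bs + Cℚ N (j ℕ.+ suc (length bs)) * b       ∎

binomSum-bernoulliList : ∀ N m → binomSum N 0 (bernoulliList m) ≡ Σ[ j < m ] Cℚ N j * B j
binomSum-bernoulliList N zero    = refl
binomSum-bernoulliList N (suc m) = begin
  binomSum N 0 (bernoulliList m ++ [ B m ])                            ≡⟨ binomSum-∷ʳ N 0 (bernoulliList m) (B m) ⟩
  binomSum N 0 (bernoulliList m) + Cℚ N (length (bernoulliList m)) * B m ≡⟨ cong₂ (λ a i → a + Cℚ N i * B m) (binomSum-bernoulliList N m) (length-bernoulliList m) ⟩
  Σ[ j < m ] Cℚ N j * B j + Cℚ N m * B m                               ≡⟨ Σ-last m (λ j → Cℚ N j * B j) ⟨
  Σ[ j < suc m ] Cℚ N j * B j                                          ∎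

B-suc : ∀ m → B (suc m) ≡ - (1/ℕ (suc (suc m)) * (Σ[ j < suc m ] Cℚ (suc (suc m)) j * B j))
B-suc m = trans (nextB-of-length (bernoulliList (suc m)) (length-bernoulliList (suc m)))
                (cong (λ t → - (1/ℕ (suc (suc m)) * t)) (binomSum-bernoulliList (suc (suc m)) (suc m)))
  where
  nextB-of-length : ∀ bs → length bs ≡ suc m → nextB bs ≡ - (1/ℕ (suc (suc m)) * binomSum (suc (suc m)) 0 bs)
  nextB-of-length bs len with length bs | len
  ... | .(suc m) | refl = refl

ΣC[L,j]B[j]≡δ[L,1] : ∀ L → Σ[ j < L ] Cℚ L j * B j ≡ δ L 1
ΣC[L,j]B[j]≡δ[L,1] zero          = refl
ΣC[L,j]B[j]≡δ[L,1] (suc zero)    = refl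
ΣC[L,j]B[j]≡δ[L,1] (suc (suc m)) = begin
  Σ[ j < suc (suc m) ] Cℚ (suc (suc m)) j * B j                  ≡⟨ Σ-last (suc m) (λ j → Cℚ (suc (suc m)) j * B j) ⟩
  T + Cℚ (suc (suc m)) (suc m) * B (suc m)                       ≡⟨ cong₂ (λ c b → T + ιₙ c * b) ([1+n]Cn≡1+n (suc m)) (B-suc m) ⟩
  T + ιₙ (suc (suc m)) * - (1/ℕ (suc (suc m)) * T)               ≡⟨ regroup T (ιₙ (suc (suc m))) (1/ℕ (suc (suc m))) ⟩
  T - ιₙ (suc (suc m)) * 1/ℕ (suc (suc m)) * T                   ≡⟨ cong (λ c → T - c * T) (ιₙ-*-1/ℕ (suc m)) ⟩
  T - 1ℚ * T                                                     ≡⟨ cancel T ⟩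
  0ℚ                                                             ∎
  where
  T = Σ[ j < suc m ] Cℚ (suc (suc m)) j * B j
  regroup : ∀ t c w → t + c * - (w * t) ≡ t - c * w * t
  regroup = solve-∀ ℚ-ring
  cancel : ∀ t → t - 1ℚ * t ≡ 0ℚ
  cancel = solve-∀ ℚ-ring

ΣC[K+L,m]C[m,K]f[m∸K] : ∀ K L (f : ℕ → ℚ) →
  Σ[ m < K ℕ.+ L ] Cℚ (K ℕ.+ L) m * (Cℚ m K * f (m ∸ K)) ≡ Cℚ (K ℕ.+ L) K * (Σ[ j < L ] Cℚ L j * f j)
ΣC[K+L,m]C[m,K]f[m∸K] K L f = begin
  Σ[ m < K ℕ.+ L ] Cℚ (K ℕ.+ L) m * (Cℚ m K * f (m ∸ K))
    ≡⟨ Σ-split K L (λ m → Cℚ (K ℕ.+ L) m * (Cℚ m K * f (m ∸ K))) ⟩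
  Σ[ m < K ] Cℚ (K ℕ.+ L) m * (Cℚ m K * f (m ∸ K)) + Σ[ j < L ] Cℚ (K ℕ.+ L) (K ℕ.+ j) * (Cℚ (K ℕ.+ j) K * f (K ℕ.+ j ∸ K))
    ≡⟨ cong₂ _+_ (Σ-zero K below) (Σ-cong′ L revision) ⟩
  0ℚ + Σ[ j < L ] Cℚ (K ℕ.+ L) K * (Cℚ L j * f j)
    ≡⟨ ℚ.+-identityˡ _ ⟩
  Σ[ j < L ] Cℚ (K ℕ.+ L) K * (Cℚ L j * f j)
    ≡⟨ Σ-*ˡ L (Cℚ (K ℕ.+ L) K) (λ j → Cℚ L j * f j) ⟩
  Cℚ (K ℕ.+ L) K * (Σ[ j < L ] Cℚ L j * f j)
    ∎
  where
  below : ∀ m → m < K → Cℚ (K ℕ.+ L) m * (Cℚ m K * f (m ∸ K)) ≡ 0ℚ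
  below m m<K = trans (cong (λ c → Cℚ (K ℕ.+ L) m * (c * f (m ∸ K))) (n<k⇒C[n,k]≡0 m<K)) (vanishing (Cℚ (K ℕ.+ L) m) (f (m ∸ K)))
    where
    vanishing : ∀ a b → a * (0ℚ * b) ≡ 0ℚ
    vanishing = solve-∀ ℚ-ring
  revision : ∀ j → Cℚ (K ℕ.+ L) (K ℕ.+ j) * (Cℚ (K ℕ.+ j) K * f (K ℕ.+ j ∸ K)) ≡ Cℚ (K ℕ.+ L) K * (Cℚ L j * f j)
  revision j = begin
    Cℚ (K ℕ.+ L) (K ℕ.+ j) * (Cℚ (K ℕ.+ j) K * f (K ℕ.+ j ∸ K))   ≡⟨ ℚ.*-assoc (Cℚ (K ℕ.+ L) (K ℕ.+ j)) (Cℚ (K ℕ.+ j) K) (f (K ℕ.+ j ∸ K)) ⟨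
    Cℚ (K ℕ.+ L) (K ℕ.+ j) * Cℚ (K ℕ.+ j) K * f (K ℕ.+ j ∸ K)     ≡⟨ cong₂ _*_ (ιₙ-* ((K ℕ.+ L) C (K ℕ.+ j)) ((K ℕ.+ j) C K)) (cong f (sym (ℕ.m+n∸m≡n K j))) ⟨
    ιₙ (((K ℕ.+ L) C (K ℕ.+ j)) ℕ.* ((K ℕ.+ j) C K)) * f j        ≡⟨ cong (λ c → ιₙ c * f j) ([a+c]C[a+b]*[a+b]Ca≡[a+c]Ca*cCb K j L) ⟩
    ιₙ (((K ℕ.+ L) C K) ℕ.* (L C j)) * f j                        ≡⟨ cong (_* f j) (ιₙ-* ((K ℕ.+ L) C K) (L C j)) ⟩
    Cℚ (K ℕ.+ L) K * Cℚ L j * f j                                 ≡⟨ ℚ.*-assoc (Cℚ (K ℕ.+ L) K) (Cℚ L j) (f j) ⟩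
    Cℚ (K ℕ.+ L) K * (Cℚ L j * f j)                               ∎

δ[K+a,K+b]≡δ[a,b] : ∀ K a b → δ (K ℕ.+ a) (K ℕ.+ b) ≡ δ a b
δ[K+a,K+b]≡δ[a,b] zero    a b = refl
δ[K+a,K+b]≡δ[a,b] (suc K) a b = trans (δ-suc (K ℕ.+ a) (K ℕ.+ b)) (δ[K+a,K+b]≡δ[a,b] K a b)

ΣC[N,m]C[m,K]B[m∸K]≡[K+1]δ[N,K+1] : ∀ N K → Σ[ m < N ] Cℚ N m * (Cℚ m K * B (m ∸ K)) ≡ ιₙ (suc K) * δ N (suc K)
ΣC[N,m]C[m,K]B[m∸K]≡[K+1]δ[N,K+1] N K = [ from-K , below-K ]′ (ℕ.≤-<-connex K N)
  where
  P : ℕ → Set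
  P n = Σ[ m < n ] Cℚ n m * (Cℚ m K * B (m ∸ K)) ≡ ιₙ (suc K) * δ n (suc K)
  below-K : N < K → P N
  below-K N<K = begin
    Σ[ m < N ] Cℚ N m * (Cℚ m K * B (m ∸ K))    ≡⟨ Σ-zero N below ⟩
    0ℚ                                          ≡⟨ ℚ.*-zeroʳ (ιₙ (suc K)) ⟨
    ιₙ (suc K) * 0ℚ                             ≡⟨ cong (ιₙ (suc K) *_) (δ-≢ (ℕ.<⇒≢ (ℕ.m<n⇒m<1+n N<K))) ⟨
    ιₙ (suc K) * δ N (suc K)                    ∎
    where
    below : ∀ m → m < N → Cℚ N m * (Cℚ m K * B (m ∸ K)) ≡ 0ℚ
    below m m<N = begin
      Cℚ N m * (Cℚ m K * B (m ∸ K))   ≡⟨ cong (λ c → Cℚ N m * (c * B (m ∸ K))) (n<k⇒C[n,k]≡0 (ℕ.<-trans m<N N<K)) ⟩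
      Cℚ N m * (0ℚ * B (m ∸ K))       ≡⟨ cong (Cℚ N m *_) (ℚ.*-zeroˡ (B (m ∸ K))) ⟩
      Cℚ N m * 0ℚ                     ≡⟨ ℚ.*-zeroʳ (Cℚ N m) ⟩
      0ℚ                              ∎
  only-L≡1-counts : ∀ L → Cℚ (K ℕ.+ L) K * δ L 1 ≡ ιₙ (suc K) * δ L 1
  only-L≡1-counts zero          = trans (ℚ.*-zeroʳ (Cℚ (K ℕ.+ 0) K)) (sym (ℚ.*-zeroʳ (ιₙ (suc K))))
  only-L≡1-counts (suc zero)    = cong (λ n → ιₙ n * 1ℚ) (trans (cong (_C K) (ℕ.+-comm K 1)) ([1+n]Cn≡1+n K))
  only-L≡1-counts (suc (suc L)) = trans (ℚ.*-zeroʳ (Cℚ (K ℕ.+ suc (suc L)) K)) (sym (ℚ.*-zeroʳ (ιₙ (suc K))))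
  from-K : K ≤ N → P N
  from-K K≤N = subst P (ℕ.m+[n∸m]≡n K≤N) (begin
    Σ[ m < K ℕ.+ L ] Cℚ (K ℕ.+ L) m * (Cℚ m K * B (m ∸ K))     ≡⟨ ΣC[K+L,m]C[m,K]f[m∸K] K L B ⟩
    Cℚ (K ℕ.+ L) K * (Σ[ j < L ] Cℚ L j * B j)                 ≡⟨ cong (Cℚ (K ℕ.+ L) K *_) (ΣC[L,j]B[j]≡δ[L,1] L) ⟩
    Cℚ (K ℕ.+ L) K * δ L 1                                     ≡⟨ only-L≡1-counts L ⟩
    ιₙ (suc K) * δ L 1                                         ≡⟨ cong (ιₙ (suc K) *_) (trans (cong (δ (K ℕ.+ L)) (sym (ℕ.+-comm K 1))) (δ[K+a,K+b]≡δ[a,b] K L 1)) ⟨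
    ιₙ (suc K) * δ (K ℕ.+ L) (suc K)                           ∎)
    where
    L = N ∸ K

C[m+1,K+1]/[m+1]≡C[m,K]/[K+1] : ∀ m K → ℤ.+ (suc m C suc K) / suc m ≡ Cℚ m K * 1/ℕ (suc K)
C[m+1,K+1]/[m+1]≡C[m,K]/[K+1] m K = trans (/-≡-*-1/ℕ (ℤ.+ (suc m C suc K)) m) (*-1/ℕ-cross m K (begin
  ιₙ (suc K) * ιₙ (suc m C suc K)          ≡⟨ ιₙ-* (suc K) (suc m C suc K) ⟨
  ιₙ (suc K ℕ.* (suc m C suc K))           ≡⟨ cong ιₙ ([1+n]*nCm≡[1+m]*[1+n]C[1+m] m K) ⟨
  ιₙ (suc m ℕ.* (m C K))                   ≡⟨ ιₙ-* (suc m) (m C K) ⟩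
  ιₙ (suc m) * Cℚ m K                      ∎))

ΣC[N,m]δ[m,k]+δ[N,k]≡C[N,k] : ∀ N k → Σ[ m < N ] Cℚ N m * δ m k + δ N k ≡ Cℚ N k
ΣC[N,m]δ[m,k]+δ[N,k]≡C[N,k] N k = trans (sym (Σ-last-C N (λ m → δ m k))) (Σ-δ (suc N) (Cℚ N) k (λ m N<m → n<k⇒C[n,k]≡0 N<m))

-- The right-hand side of the theorem at n = m + 1 and k = K + 1.
bernoulliFormula : ℕ → ℕ → ℚ
bernoulliFormula K m = (ℤ.+ (suc m C suc K) / suc m) * B (m ∸ K) + δ m (suc K)

bernoulliFormula-binomialRecurrence : ∀ K → BinomialRecurrence (λ N → Cℚ N (suc K)) (bernoulliFormula K)
bernoulliFormula-binomialRecurrence K N = begin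
  Σ[ m < N ] Cℚ N m * bernoulliFormula K m                                          ≡⟨ Σ-cong′ N split ⟩
  Σ[ m < N ] (1/ℕ (suc K) * (Cℚ N m * (Cℚ m K * B (m ∸ K))) + Cℚ N m * δ m k)
    ≡⟨ Σ-+ N (λ m → 1/ℕ (suc K) * (Cℚ N m * (Cℚ m K * B (m ∸ K)))) (λ m → Cℚ N m * δ m k) ⟩
  Σ[ m < N ] 1/ℕ (suc K) * (Cℚ N m * (Cℚ m K * B (m ∸ K))) + Σ[ m < N ] Cℚ N m * δ m k
    ≡⟨ cong (_+ Σ[ m < N ] Cℚ N m * δ m k) (Σ-*ˡ N (1/ℕ (suc K)) (λ m → Cℚ N m * (Cℚ m K * B (m ∸ K)))) ⟩
  1/ℕ (suc K) * (Σ[ m < N ] Cℚ N m * (Cℚ m K * B (m ∸ K))) + Σ[ m < N ] Cℚ N m * δ m k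
    ≡⟨ cong (λ u → 1/ℕ (suc K) * u + Σ[ m < N ] Cℚ N m * δ m k) (ΣC[N,m]C[m,K]B[m∸K]≡[K+1]δ[N,K+1] N K) ⟩
  1/ℕ (suc K) * (ιₙ (suc K) * δ N k) + Σ[ m < N ] Cℚ N m * δ m k
    ≡⟨ cong (_+ Σ[ m < N ] Cℚ N m * δ m k) (1/ℕ-*-ιₙ-* K (δ N k)) ⟩
  δ N k + Σ[ m < N ] Cℚ N m * δ m k                                                 ≡⟨ ℚ.+-comm (δ N k) _ ⟩
  Σ[ m < N ] Cℚ N m * δ m k + δ N k                                                 ≡⟨ ΣC[N,m]δ[m,k]+δ[N,k]≡C[N,k] N k ⟩
  Cℚ N k                                                                            ∎
  where
  k = suc K
  split : ∀ m → Cℚ N m * bernoulliFormula K m ≡ 1/ℕ (suc K) * (Cℚ N m * (Cℚ m K * B (m ∸ K))) + Cℚ N m * δ m k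
  split m = trans (cong (λ c → Cℚ N m * (c * B (m ∸ K) + δ m k)) (C[m+1,K+1]/[m+1]≡C[m,K]/[K+1] m K))
                  (regroup (Cℚ N m) (Cℚ m K) (1/ℕ (suc K)) (B (m ∸ K)) (δ m k))
    where
    regroup : ∀ c a w b d → c * (a * w * b + d) ≡ w * (c * (a * b)) + c * d
    regroup = solve-∀ ℚ-ring

-- Imported only now: an unqualified +_ would make sections such as (a +_) ambiguous.
open import Data.Integer using (+_)

corollary4 : (n k : ℕ) → 1 ≤ k → k ≤ n →
    Σ[ k to n ] (λ i → ((+ S n i) Data.Integer.* s i k) / suc (i ∸ 1))
    ≡ (((+ (n C k)) / suc (n ∸ 1)) * B (n ∸ k)) + δ (n ∸ 1) k
corollary4 (suc m) (suc K) (s≤s z≤n) (s≤s K≤m) = begin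
  Σ[ suc K to suc m ] F         ≡⟨ Σ-to≡Σ< F (s≤s (ℕ.m≤n⇒m≤1+n K≤m)) F-below ⟩
  Σ[ i < suc (suc m) ] F i      ≡⟨ Σ-cong′ (suc (suc m)) F≡ ⟩
  ΣSs/i (suc K) (suc m)         ≡⟨ binomialRecurrence-unique (ΣSs/i-binomialRecurrence K) (bernoulliFormula-binomialRecurrence K) m ⟩
  bernoulliFormula K m          ∎
  where
  F : ℕ → ℚ
  F i = ((+ S (suc m) i) Data.Integer.* s i (suc K)) / suc (i ∸ 1)
  F≡ : ∀ i → F i ≡ Sℚ (suc m) i * sℚ i (suc K) * 1/ℕ i
  F≡ i = trans (/-≡-*-1/ℕ (+ S (suc m) i Data.Integer.* s i (suc K)) (i ∸ 1)) (cong (_* 1/ℕ i) (ι-* (+ S (suc m) i) (s i (suc K))))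
  F-below : ∀ i → i < suc K → F i ≡ 0ℚ
  F-below i i<k = trans (F≡ i) (trans (cong (λ x → Sℚ (suc m) i * x * 1/ℕ i) (n<k⇒s[n,k]≡0 i<k)) (vanishing (Sℚ (suc m) i) (1/ℕ i)))
    where
    vanishing : ∀ a w → a * 0ℚ * w ≡ 0ℚ
    vanishing = solve-∀ ℚ-ring
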